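{- Let $n\geq 4$. Suppose that for every $s<n$, every tournament on $s$ vertices contains a copy of every oriented path on $s$ vertices, except possibly when the tournament is isomorphic to a member of $\mathcal{T}_{3,5,7}$ and the path is antidirected. Let $T$ be a tournament on $n$ vertices having a vertex $v$ with in-degree $d^-(v)=0$, and let $P=x_1\dots x_n$ be an oriented path on $n$ vertices which is not directed. Unless $P$ is of type $P^+(1,2)$ and $T-v$ is a cyclic triangle, the following hold: 1. $T$ contains a copy of $P$ whose origin is a vertex $x\neq v$. 2. If $T-v$ is isomorphic to a member of $\mathcal{T}_{3,5,7}$, then every vertex of $T-v$ is the origin of some copy of $P$ in $T$.
   Context: A tournament is an orientation of a complete finite simple graph; $d^-(v)$ is the number of arcs entering $v$, and $T-v$ is the subtournament induced on $V(T)\setminus\{v\}$. An oriented path $P=x_1\dots x_n$ is a sequence of distinct vertices where for each $1\le i<n$ exactly one of the arcs $(x_i,x_{i+1})$, $(x_{i+1},x_i)$ is present, and there are no other arcs; $x_1$ is its origin. $P$ is directed if all its arcs point in the same direction along the path (all forward or all backward), and antidirected if consecutive arcs always alternate in direction. A block is a maximal directed subpath; $P$ is of type $P^+(1,2)$ if $P=x_1x_2x_3x_4$ with arcs $(x_1,x_2),(x_3,x_2),(x_4,x_3)$. A copy of $P$ in a tournament $T$ is a sequence $v_1\dots v_n$ of distinct vertices of $T$ such that for each $i$, $(v_i,v_{i+1})$ is an arc of $T$ iff $(x_i,x_{i+1})$ is an arc of $P$; its origin is $v_1$. $\mathcal{T}_{3,5,7}=\{T_3,T_5,T_7\}$ where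 $T_3$ is the cyclic triangle; $T_5$ is the regular tournament on 5 vertices, i.e. vertices $v_1,\dots,v_5$ with $(v_i,v_j)$ an arc iff $j-i\equiv 1,2\pmod 5$; $T_7$ is the Paley tournament with vertices $v_1,\dots,v_7$ and $(v_i,v_j)$ an arc iff $j-i\equiv 1,2,4\pmod 7$. -}

module Defs where

open import Data.Nat using (ℕ; zero; suc; _+_; _∸_; _%_)
open import Data.Bool using (Bool; true; false; if_then_else_)
open import Data.Fin using (Fin; zero; suc; toℕ; inject₁; punchIn)
open import Data.Vec using (Vec; lookup; toList)
open import Data.List using (List; []; _∷_; map; allFin)
open import Data.Nat.ListAction using (sum)
open import Data.Product using (Σ; _×_)
open import Data.Sum using (_⊎_)
open import Relation.Binary.PropositionalEquality using (_≡_; _≢_)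
open import Function.Bundles using (_↔_; Inverse)
open import Function.Definitions using (Injective)

Arcs : ℕ → Set
Arcs n = Fin n → Fin n → Bool

record IsTournament {n : ℕ} (A : Arcs n) : Set where
  field
    irrefl : ∀ x → A x x ≡ false
    exactlyOne : ∀ x y → x ≢ y → (A x y ≡ true × A y x ≡ false) ⊎ (A x y ≡ false × A y x ≡ true)

indeg : {n : ℕ} → Arcs n → Fin n → ℕ
indeg {n} A v = sum (map (λ u → if A u v then 1 else 0) (allFin n))

_−_ : {n : ℕ} → Arcs (suc n) → Fin (suc n) → Arcs n
(A − v) i j = A (punchIn v i) (punchIn v j)

record Iso {m k : ℕ} (A : Arcs m) (B : Arcs k) : Set where
  field
    bij : Fin m ↔ Fin k
    preserves : ∀ x y → A x y ≡ B (Inverse.to bij x) (Inverse.to bij y)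

-- Circulant tournament on Z_{p+1} with connection set given by a Boolean predicate on residues.
circ : (p : ℕ) → (ℕ → Bool) → Arcs (suc p)
circ p S i j = S ((toℕ j + suc p ∸ toℕ i) % suc p)

T₃ : Arcs 3
T₃ = circ 2 S where
  S : ℕ → Bool
  S 1 = true
  S _ = false

T₅ : Arcs 5
T₅ = circ 4 S where
  S : ℕ → Bool
  S 1 = true
  S 2 = true
  S _ = false

T₇ : Arcs 7
T₇ = circ 6 S where
  S : ℕ → Bool
  S 1 = true
  S 2 = true
  S 4 = true
  S _ = false

InT357 : {m : ℕ} → Arcs m → Set
InT357 A = Iso A T₃ ⊎ Iso A T₅ ⊎ Iso A T₇

-- An oriented path on (suc k) vertices x₁ … x_{k+1} is encoded by its k arc directions:
-- lookup d i ≡ true  iff the i-th arc is (x_i, x_{i+1}) (forward),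
-- lookup d i ≡ false iff it is (x_{i+1}, x_i) (backward).
OPath : ℕ → Set
OPath k = Vec Bool k

Directed : {k : ℕ} → OPath k → Set
Directed d = ∀ i j → lookup d i ≡ lookup d j

Antidirected : {k : ℕ} → OPath k → Set
Antidirected {k} d = ∀ (i j : Fin k) → toℕ j ≡ suc (toℕ i) → lookup d i ≢ lookup d j

-- type P⁺(1,2): x₁x₂x₃x₄ with arcs (x₁,x₂),(x₃,x₂),(x₄,x₃)
IsP⁺12 : {k : ℕ} → OPath k → Set
IsP⁺12 d = toList d ≡ true ∷ false ∷ false ∷ []

record Copy {m k : ℕ} (A : Arcs m) (d : OPath k) : Set where
  field
    f : Fin (suc k) → Fin m
    distinct : Injective _≡_ _≡_ f
    arcs : ∀ (i : Fin k) → A (f (inject₁ i)) (f (suc i)) ≡ lookup d i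

  origin : Fin m
  origin = f zero

-- Put v, which dominates all other vertices, on a vertex of P other than the origin whose
-- incident arcs both leave it.  If P has such a vertex in its interior, delete it and join its
-- two neighbours by an arc chosen so that the shorter path Q is not antidirected; otherwise P
-- consists of forward arcs followed by backward arcs, its last vertex is such a vertex, and the
-- path Q left by deleting it is antidirected only when P is P⁺(1,2).  A copy of Q in T - v,
-- given by the induction hypothesis, then extends to a copy of P with the same origin.  When
-- T - v is one of T₃, T₅, T₇, vertex-transitivity moves the origin of the copy of Q anywhere.
module Submission where

open import Defs
open import Data.Bool using (true; false; if_then_else_)
import Data.Bool.Properties as Bool
open import Data.Empty using (⊥-elim)
open import Data.Fin using (Fin; zero; suc; toℕ; inject₁; punchIn)
open import Data.Fin.Properties
  using (_≟_; all?; any?; punchIn-injective; punchInᵢ≢i; punchIn-punchOut; cantor-schröder-bernstein)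
open import Data.List using ([]; _∷_)
open import Data.List.Membership.Propositional.Properties using (∈-allFin)
open import Data.List.Relation.Unary.All as All using (All; []; _∷_)
open import Data.List.Relation.Unary.All.Properties using (map⁻)
open import Data.Nat using (ℕ; zero; suc; _+_; _≤_; _<_; s≤s; z≤n)
open import Data.Nat.DivMod using (_mod_)
open import Data.Nat.ListAction using (sum)
open import Data.Nat.Properties using (≤-refl; m+n≡0⇒m≡0; m+n≡0⇒n≡0)
open import Data.Product using (Σ; ∃; _×_; _,_; proj₁; proj₂)
open import Data.Sum using (_⊎_; inj₁; inj₂)
open import Data.Vec using ([]; _∷_; lookup; replicate; _∷ʳ_)
open import Data.Vec.Properties using (lookup-replicate)
open import Data.Vec.Functional using (insertAt)
open import Data.Vec.Functional.Properties using (insertAt-lookup; insertAt-punchIn)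
open import Function using (_∘_)
open import Function.Bundles using (Inverse; Injection)
open import Function.Definitions using (Injective)
open import Function.Properties.Inverse using (↔-sym; ↔⇒↣)
open import Relation.Binary.PropositionalEquality
  using (_≡_; _≢_; refl; sym; trans; cong; cong₂)
open import Relation.Nullary using (¬_; Dec; yes; no)
open import Relation.Nullary.Decidable using (True; toWitness)

sum≡0⇒All≡0 : ∀ ns → sum ns ≡ 0 → All (_≡ 0) ns
sum≡0⇒All≡0 []       _  = []
sum≡0⇒All≡0 (n ∷ ns) eq = m+n≡0⇒m≡0 n eq ∷ sum≡0⇒All≡0 ns (m+n≡0⇒n≡0 n eq)

if-1-0≡0⇒false : ∀ b → (if b then 1 else 0) ≡ 0 → b ≡ false
if-1-0≡0⇒false false _ = refl

indeg≡0⇒no-arc-into : ∀ {n} (T : Arcs n) v → indeg T v ≡ 0 → ∀ u → T u v ≡ false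
indeg≡0⇒no-arc-into T v indeg≡0 u =
  if-1-0≡0⇒false (T u v) (All.lookup (map⁻ (sum≡0⇒All≡0 _ indeg≡0)) (∈-allFin u))

no-arc-into⇒arc-from : ∀ {n} {T : Arcs n} → IsTournament T → ∀ v → (∀ u → T u v ≡ false)
                     → ∀ u → u ≢ v → T v u ≡ true
no-arc-into⇒arc-from tour v into u u≢v with IsTournament.exactlyOne tour v u (u≢v ∘ sym)
... | inj₁ (v→u , _) = v→u
... | inj₂ (_ , u→v) with trans (sym u→v) (into u)
...   | ()

−-isTournament : ∀ {n} {T : Arcs (suc n)} → IsTournament T → ∀ v → IsTournament (T − v)
−-isTournament tour v = record
  { irrefl     = λ x → IsTournament.irrefl tour (punchIn v x)
  ; exactlyOne = λ x y x≢y → IsTournament.exactlyOne tour (punchIn v x) (punchIn v y)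
                                (x≢y ∘ punchIn-injective v x y)
  }

record Embedding {m n} (A : Arcs m) (B : Arcs n) : Set where
  field
    to        : Fin m → Fin n
    injective : Injective _≡_ _≡_ to
    preserves : ∀ x y → B (to x) (to y) ≡ A x y

_∘ᴱ_ : ∀ {l m n} {A : Arcs l} {B : Arcs m} {C : Arcs n} → Embedding B C → Embedding A B → Embedding A C
σ ∘ᴱ τ = record
  { to        = Embedding.to σ ∘ Embedding.to τ
  ; injective = Embedding.injective τ ∘ Embedding.injective σ
  ; preserves = λ x y → trans (Embedding.preserves σ _ _) (Embedding.preserves τ x y)
  }

mapCopy : ∀ {m n k} {A : Arcs m} {B : Arcs n} {d : OPath k} (σ : Embedding A B) (c : Copy A d)
        → Σ (Copy B d) λ c′ → Copy.origin c′ ≡ Embedding.to σ (Copy.origin c)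
mapCopy σ c = record
  { f        = Embedding.to σ ∘ Copy.f c
  ; distinct = Copy.distinct c ∘ Embedding.injective σ
  ; arcs     = λ i → trans (Embedding.preserves σ _ _) (Copy.arcs c i)
  } , refl

Iso-sym : ∀ {m n} {A : Arcs m} {B : Arcs n} → Iso A B → Iso B A
Iso-sym {B = B} iso = record
  { bij       = ↔-sym bij
  ; preserves = λ x y → trans (cong₂ B (sym (strictlyInverseˡ x)) (sym (strictlyInverseˡ y)))
                              (sym (preserves (from x) (from y)))
  }
  where open Iso iso; open Inverse bij

Iso⇒Embedding : ∀ {m n} {A : Arcs m} {B : Arcs n} → Iso A B → Embedding A B
Iso⇒Embedding iso = record
  { to        = Inverse.to (Iso.bij iso)
  ; injective = Injection.injective (↔⇒↣ (Iso.bij iso))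
  ; preserves = λ x y → sym (Iso.preserves iso x y)
  }

Iso⇒≡ : ∀ {m n} {A : Arcs m} {B : Arcs n} → Iso A B → m ≡ n
Iso⇒≡ iso = cantor-schröder-bernstein (Embedding.injective (Iso⇒Embedding iso))
                                      (Embedding.injective (Iso⇒Embedding (Iso-sym iso)))

VertexTransitive : ∀ {n} → Arcs n → Set
VertexTransitive A = ∀ a b → Σ (Embedding A A) λ σ → Embedding.to σ a ≡ b

Iso-vertexTransitive : ∀ {m n} {A : Arcs m} {B : Arcs n} → Iso A B → VertexTransitive B → VertexTransitive A
Iso-vertexTransitive {A = A} {B} iso transitive a b = conjugate (transitive (to a) (to b))
  where
  open Inverse (Iso.bij iso) using (to; from; strictlyInverseʳ)
  conjugate : Σ (Embedding B B) (λ σ → Embedding.to σ (to a) ≡ to b)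
            → Σ (Embedding A A) (λ τ → Embedding.to τ a ≡ b)
  conjugate (σ , σ-maps) = Iso⇒Embedding (Iso-sym iso) ∘ᴱ (σ ∘ᴱ Iso⇒Embedding iso)
                         , trans (cong from σ-maps) (strictlyInverseʳ b)

reroot : ∀ {n k} {A : Arcs n} {d : OPath k} → VertexTransitive A → Copy A d
       → ∀ u → Σ (Copy A d) λ c → Copy.origin c ≡ u
reroot transitive c u with transitive (Copy.origin c) u
... | σ , σ-origin = proj₁ (mapCopy σ c) , trans (proj₂ (mapCopy σ c)) σ-origin

transitiveFamily⇒vertexTransitive : ∀ {n} (B : Arcs n) (ρ : Fin n → Fin n → Fin n)
  → (∀ a b → ∃ λ d → ρ d a ≡ b)
  → (∀ d → ∃ λ d′ → ∀ x → ρ d′ (ρ d x) ≡ x)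
  → (∀ d x y → B (ρ d x) (ρ d y) ≡ B x y)
  → VertexTransitive B
transitiveFamily⇒vertexTransitive B ρ transitive invertible preserves a b =
  ρ-embedding (proj₁ (transitive a b)) , proj₂ (transitive a b)
  where
  ρ-embedding : ∀ d → Embedding B B
  ρ-embedding d = record { to = ρ d ; injective = injective ; preserves = preserves d }
    where
    injective : Injective _≡_ _≡_ (ρ d)
    injective {x} {y} eq with invertible d
    ... | d′ , ρd′∘ρd≗id = trans (sym (ρd′∘ρd≗id x)) (trans (cong (ρ d′) eq) (ρd′∘ρd≗id y))

rotate : ∀ {p} → Fin (suc p) → Fin (suc p) → Fin (suc p)
rotate {p} d x = (toℕ x + toℕ d) mod suc p

rotations-transitive? : ∀ p → Dec (∀ (a b : Fin (suc p)) → ∃ λ d → rotate d a ≡ b)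
rotations-transitive? p = all? λ a → all? λ b → any? λ d → rotate d a ≟ b

rotations-invertible? : ∀ p → Dec (∀ (d : Fin (suc p)) → ∃ λ d′ → ∀ x → rotate d′ (rotate d x) ≡ x)
rotations-invertible? p = all? λ d → any? λ d′ → all? λ x → rotate d′ (rotate d x) ≟ x

rotationInvariant? : ∀ {p} (B : Arcs (suc p)) → Dec (∀ d x y → B (rotate d x) (rotate d y) ≡ B x y)
rotationInvariant? B = all? λ d → all? λ x → all? λ y → B (rotate d x) (rotate d y) Bool.≟ B x y

rotationInvariant⇒vertexTransitive : ∀ {p} (B : Arcs (suc p))
  → True (rotations-transitive? p) → True (rotations-invertible? p) → True (rotationInvariant? B)
  → VertexTransitive B
rotationInvariant⇒vertexTransitive B transitive invertible invariant = transitiveFamily⇒vertexTransitive B rotate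
  (toWitness transitive) (toWitness invertible) (toWitness {a? = rotationInvariant? B} invariant)

InT357⇒vertexTransitive : ∀ {n} {A : Arcs n} → InT357 A → VertexTransitive A
InT357⇒vertexTransitive (inj₁ iso)        = Iso-vertexTransitive iso (rotationInvariant⇒vertexTransitive T₃ _ _ _)
InT357⇒vertexTransitive (inj₂ (inj₁ iso)) = Iso-vertexTransitive iso (rotationInvariant⇒vertexTransitive T₅ _ _ _)
InT357⇒vertexTransitive (inj₂ (inj₂ iso)) = Iso-vertexTransitive iso (rotationInvariant⇒vertexTransitive T₇ _ _ _)

≡-or-punchIn : ∀ {n} (i x : Fin (suc n)) → x ≡ i ⊎ ∃ λ j → punchIn i j ≡ x
≡-or-punchIn i x with i ≟ x
... | yes refl = inj₁ refl
... | no  i≢x  = inj₂ (_ , punchIn-punchOut i≢x)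

insertAt-injective : ∀ {n} {A : Set} (xs : Fin n → A) i v
  → Injective _≡_ _≡_ xs → (∀ j → xs j ≢ v) → Injective _≡_ _≡_ (insertAt xs i v)
insertAt-injective xs i v xs-injective v∉xs {x} {y} eq with ≡-or-punchIn i x | ≡-or-punchIn i y
... | inj₁ refl       | inj₁ refl        = refl
... | inj₁ refl       | inj₂ (j , refl)  = ⊥-elim (v∉xs j (trans (sym (insertAt-punchIn xs i v j))
                                                   (trans (sym eq) (insertAt-lookup xs i v))))
... | inj₂ (j , refl) | inj₁ refl        = ⊥-elim (v∉xs j (trans (sym (insertAt-punchIn xs i v j))
                                                   (trans eq (insertAt-lookup xs i v))))
... | inj₂ (j , refl) | inj₂ (j′ , refl) = cong (punchIn i) (xs-injective
  (trans (sym (insertAt-punchIn xs i v j)) (trans eq (insertAt-punchIn xs i v j′))))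

withFirstForward : ∀ {k} → OPath k → OPath k
withFirstForward []      = []
withFirstForward (_ ∷ d) = true ∷ d

-- SourceInsertion Q P: P arises from Q by inserting, right after some vertex of Q, a new vertex
-- whose incident arcs both leave it; the arc of Q that joined its two neighbours disappears.
data SourceInsertion : ∀ {k} → OPath k → OPath (suc k) → Set where
  here  : ∀ {k} (Q : OPath k) → SourceInsertion Q (false ∷ withFirstForward Q)
  there : ∀ {k} b {Q : OPath k} {P} → SourceInsertion Q P → SourceInsertion (b ∷ Q) (b ∷ P)

gap : ∀ {k} {Q : OPath k} {P} → SourceInsertion Q P → Fin (suc k)
gap (here _)    = zero
gap (there _ s) = suc (gap s)

insertAt-arcs : ∀ {N k} (T : Arcs N) v {Q : OPath k} {P} (s : SourceInsertion Q P) (xs : Fin (suc k) → Fin N)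
  → (∀ x → T (xs x) v ≡ false) → (∀ x → T v (xs x) ≡ true)
  → (∀ i → T (xs (inject₁ i)) (xs (suc i)) ≡ lookup Q i)
  → ∀ i → T (insertAt xs (suc (gap s)) v (inject₁ i)) (insertAt xs (suc (gap s)) v (suc i)) ≡ lookup P i
insertAt-arcs T v (here _)       xs into out arcs zero          = into zero
insertAt-arcs T v (here (_ ∷ _)) xs into out arcs (suc zero)    = out (suc zero)
insertAt-arcs T v (here (_ ∷ _)) xs into out arcs (suc (suc i)) = arcs (suc i)
insertAt-arcs T v (there _ s)    xs into out arcs zero          = arcs zero
insertAt-arcs T v (there _ s)    xs into out arcs (suc i)       =
  insertAt-arcs T v s (xs ∘ suc) (into ∘ suc) (out ∘ suc) (arcs ∘ suc) i

extendCopy : ∀ {n k} (T : Arcs (suc n)) v → (∀ u → T u v ≡ false) → (∀ u → u ≢ v → T v u ≡ true)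
  → {Q : OPath k} {P : OPath (suc k)} → SourceInsertion Q P
  → (c : Copy (T − v) Q) → Σ (Copy T P) λ c′ → Copy.origin c′ ≡ punchIn v (Copy.origin c)
extendCopy {n} {k} T v into out s c = record
  { f        = insertAt xs (suc (gap s)) v
  ; distinct = insertAt-injective xs (suc (gap s)) v
                 (Copy.distinct c ∘ punchIn-injective v _ _) (λ _ → punchInᵢ≢i v _)
  ; arcs     = insertAt-arcs T v s xs (into ∘ xs) (λ x → out (xs x) (punchInᵢ≢i v _)) (Copy.arcs c)
  } , refl
  where
  xs : Fin (suc k) → Fin (suc n)
  xs = punchIn v ∘ Copy.f c

data InteriorSource : ∀ {k} → OPath k → Set where
  here  : ∀ {k} (d : OPath k) → InteriorSource (false ∷ true ∷ d)
  there : ∀ {k} b {d : OPath k} → InteriorSource d → InteriorSource (b ∷ d)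

data NonIncreasing : ∀ {k} → OPath k → Set where
  backward : ∀ k → NonIncreasing (replicate k false)
  true∷_   : ∀ {k} {d : OPath k} → NonIncreasing d → NonIncreasing (true ∷ d)

data SourceView : ∀ {k} → OPath k → Set where
  interior : ∀ {k} {d : OPath k} → InteriorSource d → SourceView d
  forward  : ∀ {k} → SourceView (replicate k true)
  terminal : ∀ {k} {d : OPath k} → NonIncreasing d → SourceView (d ∷ʳ false)

sourceView : ∀ {k} (d : OPath k) → SourceView d
sourceView []      = forward
sourceView (b ∷ d) with sourceView d
... | interior s = interior (there b s)
sourceView (true  ∷ _) | forward            = forward
sourceView (false ∷ _) | forward {zero}     = terminal (backward zero)
sourceView (false ∷ _) | forward {suc _}    = interior (here _)
sourceView (true  ∷ _) | terminal d         = terminal (true∷ d)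
sourceView (false ∷ _) | terminal (backward k) = terminal (backward (suc k))
sourceView (false ∷ _) | terminal (true∷ _) = interior (here _)

replicate-directed : ∀ {k} b → Directed (replicate k b)
replicate-directed b i j = trans (lookup-replicate i b) (sym (lookup-replicate j b))

antidirected-tail : ∀ {k} {b} {d : OPath k} → Antidirected (b ∷ d) → Antidirected d
antidirected-tail ad i j j≡1+i = ad (suc i) (suc j) (cong suc j≡1+i)

repeat-¬antidirected : ∀ {k} b (d : OPath k) → ¬ Antidirected (b ∷ b ∷ d)
repeat-¬antidirected b d ad = ad zero (suc zero) refl refl

SourceRemoval : ∀ {k} → OPath (suc k) → (OPath k → Set) → Set
SourceRemoval P Good = Σ (OPath _) λ Q → SourceInsertion Q P × Good Q

-- The arc joining the two neighbours of an interior source is chosen equal to an adjacent arc.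
interiorSource-removal : ∀ {k} {P : OPath (suc (suc (suc k)))} → InteriorSource P
                 → SourceRemoval P (¬_ ∘ Antidirected)
interiorSource-removal (here (r ∷ d)) = r ∷ r ∷ d , here (r ∷ r ∷ d) , repeat-¬antidirected r d
interiorSource-removal (there b s)    = after b s
  where
  after : ∀ {k} b {P : OPath k} → InteriorSource P → SourceRemoval (b ∷ P) (¬_ ∘ Antidirected)
  after b (here d)     = b ∷ b ∷ d , there b (here (b ∷ d)) , repeat-¬antidirected b d
  after b (there b′ s) with after b′ s
  ... | Q , ins , ¬ad = b ∷ Q , there b ins , ¬ad ∘ antidirected-tail

sourceInsertion-∷ʳ : ∀ {k} (Q : OPath k) → SourceInsertion Q (Q ∷ʳ false)
sourceInsertion-∷ʳ []      = here []
sourceInsertion-∷ʳ (b ∷ Q) = there b (sourceInsertion-∷ʳ Q)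

terminal-¬InT357×antidirected : ∀ {k} {Q : OPath (suc (suc k))} (A : Arcs (suc (suc (suc k))))
  → NonIncreasing Q → ¬ (IsP⁺12 (Q ∷ʳ false) × Iso A T₃) → ¬ (InT357 A × Antidirected Q)
terminal-¬InT357×antidirected A (backward _)       _   (_ , ad) = repeat-¬antidirected false _ ad
terminal-¬InT357×antidirected A (true∷ (true∷ _))  _   (_ , ad) = repeat-¬antidirected true _ ad
terminal-¬InT357×antidirected A (true∷ backward (suc (suc _))) _ (_ , ad) =
  repeat-¬antidirected false _ (antidirected-tail ad)
terminal-¬InT357×antidirected A (true∷ backward 1) exc (inj₁ iso , _)        = exc (refl , iso)
terminal-¬InT357×antidirected A (true∷ backward 1) _   (inj₂ (inj₁ iso) , _) with Iso⇒≡ iso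
... | ()
terminal-¬InT357×antidirected A (true∷ backward 1) _   (inj₂ (inj₂ iso) , _) with Iso⇒≡ iso
... | ()

source-removal : ∀ {k} (P : OPath (suc (suc (suc k)))) (A : Arcs (suc (suc (suc k))))
  → ¬ Directed P → ¬ (IsP⁺12 P × Iso A T₃) → SourceRemoval P λ Q → ¬ (InT357 A × Antidirected Q)
source-removal P A ¬directed exc with sourceView P
... | interior s with interiorSource-removal s
...   | Q , ins , ¬ad = Q , ins , ¬ad ∘ proj₂
source-removal P A ¬directed exc | forward = ⊥-elim (¬directed (replicate-directed true))
source-removal P A ¬directed exc | terminal {d = Q} Q↓ =
  Q , sourceInsertion-∷ʳ Q , terminal-¬InT357×antidirected A Q↓ exc

lemma2 : (m : ℕ) → 4 ≤ suc m
    → (∀ (k : ℕ) → suc k < suc m → (A : Arcs (suc k)) → IsTournament A → (d : OPath k)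
         → ¬ (InT357 A × Antidirected d) → Copy A d)
    → (T : Arcs (suc m)) → IsTournament T → (v : Fin (suc m)) → indeg T v ≡ 0
    → (P : OPath m) → ¬ Directed P
    → ¬ (IsP⁺12 P × Iso (T − v) T₃)
    → (Σ (Copy T P) λ c → Copy.origin c ≢ v)
      × (InT357 (T − v) → ∀ (u : Fin m) → Σ (Copy T P) λ c → Copy.origin c ≡ punchIn v u)
lemma2 (suc (suc (suc k))) (s≤s (s≤s (s≤s (s≤s z≤n)))) copies T tour v indeg≡0 P ¬directed exc
  with source-removal P (T − v) ¬directed exc
... | Q , insertion , admissible =
  (proj₁ (extend c) , punchInᵢ≢i v _ ∘ trans (sym (proj₂ (extend c))))
  , λ inT357 u → let c′ , c′-origin = reroot (InT357⇒vertexTransitive inT357) c u in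
      proj₁ (extend c′) , trans (proj₂ (extend c′)) (cong (punchIn v) c′-origin)
  where
  into : ∀ u → T u v ≡ false
  into = indeg≡0⇒no-arc-into T v indeg≡0
  c : Copy (T − v) Q
  c = copies _ ≤-refl (T − v) (−-isTournament tour v) Q admissible
  extend : (c : Copy (T − v) Q) → Σ (Copy T P) λ c′ → Copy.origin c′ ≡ punchIn v (Copy.origin c)
  extend = extendCopy T v into (no-arc-into⇒arc-from tour v into) insertion
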